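{- Let $G$ be a median graph, $v_0$ a vertex of $G$, and consider a BFS from $v_0$ with its total order $<$ on vertices and the induced order on edges. An edge $uv\in E_i$ with $d(v_0,u)<d(v_0,v)$ is the first edge (in this edge order) of its $\Theta$-class $E_i$ if and only if $u$ is the unique predecessor of $v$, i.e. $\Lambda(v)=\{u\}$.
   Context: $G$ is a finite connected median graph: for every triple $x,y,z$ of vertices, $I(x,y)\cap I(y,z)\cap I(z,x)$ is a single vertex, where $I(u,v)=\{x:d(u,x)+d(x,v)=d(u,v)\}$. Two edges are in relation $\Theta_0$ if they are opposite edges of a 4-cycle; the $\Theta$-classes are the equivalence classes of the reflexive-transitive closure of $\Theta_0$. BFS from $v_0$ defines a total order $<$ on vertices (order of insertion into the queue). For edges $uv,u'v'$ with $u<v$, $u'<v'$, set $uv<u'v'$ iff $u<u'$, or $u=u'$ and $v<v'$. The set $\Lambda(v)$ of predecessors of $v$ is the set of neighbors $u$ of $v$ with $d(v_0,u)<d(v_0,v)$. -}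

module Defs where

open import Data.Nat using (ℕ; zero; suc; _+_; _≤_; _<_; _<ᵇ_)
open import Data.Fin using (Fin; toℕ)
open import Data.Bool using (Bool; true; false; T; if_then_else_)
open import Data.Product using (Σ; ∃; _×_; _,_)
open import Data.Sum using (_⊎_)
open import Relation.Binary.PropositionalEquality using (_≡_; _≢_)
open import Relation.Binary.Construct.Closure.ReflexiveTransitive using (Star)
open import Relation.Nullary using (¬_)
open import Function.Definitions using (Injective)

record Graph : Set where
  field
    n     : ℕ
    adj   : Fin n → Fin n → Bool
    sym   : ∀ u v → adj u v ≡ adj v u
    irrefl : ∀ u → adj u u ≡ false

module _ (G : Graph) where
  open Graph G

  V : Set
  V = Fin n

  Adj : V → V → Set
  Adj u v = T (adj u v)

  data Walk : V → V → ℕ → Set where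
    here : ∀ {u} → Walk u u 0
    step : ∀ {u w v k} → Adj u w → Walk w v k → Walk u v (suc k)

  Connected : Set
  Connected = ∀ u v → ∃ λ k → Walk u v k

  Dist : V → V → ℕ → Set
  Dist u v k = Walk u v k × (∀ m → Walk u v m → k ≤ m)

  InInterval : V → V → V → Set
  InInterval u v x = Σ ℕ λ a → Σ ℕ λ b → Σ ℕ λ c →
    Dist u x a × Dist x v b × Dist u v c × a + b ≡ c

  IsMedian : Set
  IsMedian = ∀ x y z → Σ V λ m →
    (InInterval x y m × InInterval y z m × InInterval z x m) ×
    (∀ m' → InInterval x y m' × InInterval y z m' × InInterval z x m' → m' ≡ m)

  Opposite : V × V → V × V → Set
  Opposite (a , b) (c , d) =
    Adj a b × Adj c d ×
    ((Adj b c × Adj d a) ⊎ (Adj b d × Adj c a)) ×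
    a ≢ b × a ≢ c × a ≢ d × b ≢ c × b ≢ d × c ≢ d

  SameEdge : V × V → V × V → Set
  SameEdge (a , b) (c , d) = (a ≡ c × b ≡ d) ⊎ (a ≡ d × b ≡ c)

  ThetaStep : V × V → V × V → Set
  ThetaStep e f = Opposite e f ⊎ SameEdge e f

  -- Θ: reflexive-transitive closure of Θ₀ (on edges, read as unordered pairs)
  Θ : V × V → V × V → Set
  Θ = Star ThetaStep

  -- A BFS from v₀, given by its insertion order pos (pos u < pos v  ⇔  u < v).
  -- The parent of v ≠ v₀ is its earliest neighbour, which precedes v, and
  -- vertices are inserted in the order their parents are processed.
  module _ (v₀ : V) where
    _≺_ : (V → Fin n) → V → V → Set
    (pos ≺ u) v = toℕ (pos u) < toℕ (pos v)

    IsFirstNeighbour : (V → Fin n) → V → V → Set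
    IsFirstNeighbour pos p v =
      Adj p v × (pos ≺ p) v × (∀ w → Adj w v → toℕ (pos p) ≤ toℕ (pos w))

    record BFS : Set where
      field
        pos       : V → Fin n
        pos-inj   : Injective _≡_ _≡_ pos
        root-first : ∀ v → toℕ (pos v₀) ≤ toℕ (pos v)
        parent    : ∀ v → v ≢ v₀ → Σ V λ p → IsFirstNeighbour pos p v
        insertion : ∀ v w p q → v ≢ v₀ → w ≢ v₀ →
                    IsFirstNeighbour pos p v → IsFirstNeighbour pos q w →
                    (pos ≺ p) q → (pos ≺ v) w

    module _ (B : BFS) where
      open BFS B

      lo hi : V → V → V
      lo a b = if toℕ (pos a) <ᵇ toℕ (pos b) then a else b
      hi a b = if toℕ (pos a) <ᵇ toℕ (pos b) then b else a

      EdgeLt : V × V → V × V → Set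
      EdgeLt (a , b) (c , d) =
        (pos ≺ lo a b) (lo c d) ⊎ (lo a b ≡ lo c d × (pos ≺ hi a b) (hi c d))

      FirstOfClass : V → V → Set
      FirstOfClass u v = ∀ c d → Adj c d → Θ (u , v) (c , d) → ¬ EdgeLt (c , d) (u , v)

      IsPred : V → V → Set
      IsPred u v = Adj u v × Σ ℕ λ a → Σ ℕ λ b → Dist v₀ u a × Dist v₀ v b × a < b

      PredsSingleton : V → V → Set
      PredsSingleton u v = IsPred u v × (∀ w → IsPred w v → w ≡ u)

-- Every edge Θ-related to uv crosses from the halfspace
-- W(u,v) = {z | d(z,u) < d(z,v)} to W(v,u), because in a median graph a
-- vertex has at most one neighbour across such a cut.  If Λ(v) = {u}, then
-- W(v,u) is gated at v, so every such edge other than uv has both ends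
-- farther from v₀ than u; as BFS order refines distance from v₀, it comes
-- after uv.  Conversely, a second predecessor w of v lies at distance 2 from
-- u, and the quadrangle condition gives a common neighbour x of u and w one
-- step closer to v₀: the square u v w x makes wx Θ uv, and wx precedes uv.
module Submission where

open import Defs
open import Data.Nat
open import Data.Nat.Properties
open import Data.Fin using (toℕ)
import Data.Fin as Fin
open import Data.Fin.Properties using (any?; toℕ-injective)
open import Data.Bool using (T; true; false)
open import Data.Unit using (tt)
open import Data.Product using (∃; _×_; _,_; proj₁; proj₂)
import Data.Product as Prod
open import Data.Sum using (_⊎_; inj₁; inj₂; [_,_]′)
open import Function using (_∘_; id)
open import Function.Bundles using (_⇔_; mk⇔)
open import Relation.Nullary using (¬_; Dec; yes; no; contradiction)
open import Relation.Nullary.Decidable using (map′; _×-dec_; T?)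
open import Relation.Unary using (Decidable)
open import Relation.Binary using (tri<; tri≈; tri>)
open import Relation.Binary.PropositionalEquality
open import Relation.Binary.Construct.Closure.ReflexiveTransitive using (ε; _◅_)

least-witness : ∀ {p} {P : ℕ → Set p} → Decidable P → ∀ {n} → P n →
                ∃ λ k → P k × (∀ m → P m → k ≤ m)
least-witness P? {zero} p = 0 , p , λ _ _ → z≤n
least-witness P? {suc n} p with P? 0
... | yes p₀ = 0 , p₀ , λ _ _ → z≤n
... | no ¬p₀ with least-witness (P? ∘ suc) p
...   | k , pk , least = suc k , pk , λ
  { zero p₀ → contradiction p₀ ¬p₀
  ; (suc m) pm → s≤s (least m pm) }

n+n≡2⇒n≡1 : ∀ {n} → n + n ≡ 2 → n ≡ 1
n+n≡2⇒n≡1 {suc zero} _ = refl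
n+n≡2⇒n≡1 {suc (suc n)} e = contradiction (suc-injective (suc-injective e)) (m+1+n≢0 n)

module Walks (G : Graph) where

  Adj-sym : ∀ {x y} → Adj G x y → Adj G y x
  Adj-sym {x} {y} = subst T (Graph.sym G x y)

  Adj-irrefl : ∀ {x y} → Adj G x y → x ≢ y
  Adj-irrefl {x} a refl = subst T (Graph.irrefl G x) a

  _++ʷ_ : ∀ {x y z j k} → Walk G x y j → Walk G y z k → Walk G x z (j + k)
  here ++ʷ q = q
  step a p ++ʷ q = step a (p ++ʷ q)

  reverseʷ : ∀ {x y k} → Walk G x y k → Walk G y x k
  reverseʷ here = here
  reverseʷ {k = suc k} (step a p) =
    subst (Walk G _ _) (+-comm k 1) (reverseʷ p ++ʷ step (Adj-sym a) here)

  walk? : ∀ k x y → Dec (Walk G x y k)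
  walk? zero x y = map′ (λ { refl → here }) (λ { here → refl }) (x Fin.≟ y)
  walk? (suc k) x y =
    map′ (λ (_ , a , p) → step a p) (λ { (step a p) → _ , a , p })
         (any? λ w → T? (Graph.adj G x w) ×-dec walk? k w y)

  Walk⇒≡ : ∀ {x y} → Walk G x y 0 → x ≡ y
  Walk⇒≡ here = refl

  Walk⇒Adj : ∀ {x y} → Walk G x y 1 → Adj G x y
  Walk⇒Adj (step a here) = a

module Distance (G : Graph) (conn : Connected G) where
  open Walks G public

  dist : ∀ x y → ∃ (Dist G x y)
  dist x y = least-witness (λ k → walk? k x y) (proj₂ (conn x y))

  d : V G → V G → ℕ
  d x y = proj₁ (dist x y)

  Dist-d : ∀ x y → Dist G x y (d x y)
  Dist-d x y = proj₂ (dist x y)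

  d-walk : ∀ x y → Walk G x y (d x y)
  d-walk x y = proj₁ (Dist-d x y)

  d-minimal : ∀ {x y k} → Walk G x y k → d x y ≤ k
  d-minimal {x} {y} = proj₂ (Dist-d x y) _

  Dist⇒≡d : ∀ {x y k} → Dist G x y k → k ≡ d x y
  Dist⇒≡d {x} {y} (w , minimal) = ≤-antisym (minimal _ (d-walk x y)) (d-minimal w)

  d-triangle : ∀ x y z → d x z ≤ d x y + d y z
  d-triangle x y z = d-minimal (d-walk x y ++ʷ d-walk y z)

  d-sym : ∀ x y → d x y ≡ d y x
  d-sym x y = ≤-antisym (d-minimal (reverseʷ (d-walk y x))) (d-minimal (reverseʷ (d-walk x y)))

  d-refl : ∀ x → d x x ≡ 0
  d-refl x = n≤0⇒n≡0 (d-minimal {x} here)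

  d≡0⇒≡ : ∀ {x y} → d x y ≡ 0 → x ≡ y
  d≡0⇒≡ {x} {y} e = Walk⇒≡ (subst (Walk G x y) e (d-walk x y))

  d≡1⇒Adj : ∀ {x y} → d x y ≡ 1 → Adj G x y
  d≡1⇒Adj {x} {y} e = Walk⇒Adj (subst (Walk G x y) e (d-walk x y))

  Adj⇒d≡1 : ∀ {x y} → Adj G x y → d x y ≡ 1
  Adj⇒d≡1 a = ≤-antisym (d-minimal (step a here)) (n≢0⇒n>0 (Adj-irrefl a ∘ d≡0⇒≡))

  d-adjˡ : ∀ {x w} y → Adj G x w → d x y ≤ suc (d w y)
  d-adjˡ {x} {w} y a = begin
    d x y         ≤⟨ d-triangle x w y ⟩
    d x w + d w y ≡⟨ cong (_+ d w y) (Adj⇒d≡1 a) ⟩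
    suc (d w y)   ∎
    where open ≤-Reasoning

  d-adjʳ : ∀ x {w y} → Adj G w y → d x y ≤ suc (d x w)
  d-adjʳ x {w} {y} a = begin
    d x y         ≡⟨ d-sym x y ⟩
    d y x         ≤⟨ d-adjˡ x (Adj-sym a) ⟩
    suc (d w x)   ≡⟨ cong suc (d-sym w x) ⟩
    suc (d x w)   ∎
    where open ≤-Reasoning

  d≡2 : ∀ {y₁ y₂ w} → y₁ ≢ y₂ → Adj G y₁ w → Adj G y₂ w → ¬ Adj G y₁ y₂ → d y₁ y₂ ≡ 2
  d≡2 {y₁} {y₂} y₁≢y₂ y₁w y₂w ¬y₁y₂
    with d y₁ y₂ in e | d-minimal (step y₁w (step (Adj-sym y₂w) here))
  ... | 0 | _ = contradiction (d≡0⇒≡ e) y₁≢y₂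
  ... | 1 | _ = contradiction (d≡1⇒Adj e) ¬y₁y₂
  ... | 2 | _ = refl
  ... | suc (suc (suc _)) | s≤s (s≤s ())

  geodesic-step : ∀ {x y k} → d x y ≡ suc k → ∃ λ w → Adj G x w × d w y ≡ k
  geodesic-step {x} {y} {k} e with subst (Walk G x y) e (d-walk x y)
  ... | step {w = w} a p = w , a , ≤-antisym (d-minimal p) (≤-pred (begin
    suc k       ≡⟨ e ⟨
    d x y       ≤⟨ d-adjˡ y a ⟩
    suc (d w y) ∎))
    where open ≤-Reasoning

  Between : V G → V G → V G → Set
  Between x m y = d x m + d m y ≡ d x y

  Between-sym : ∀ {x m y} → Between x m y → Between y m x
  Between-sym {x} {m} {y} b = begin
    d y m + d m x ≡⟨ +-comm (d y m) (d m x) ⟩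
    d m x + d y m ≡⟨ cong₂ _+_ (d-sym m x) (d-sym y m) ⟩
    d x m + d m y ≡⟨ b ⟩
    d x y         ≡⟨ d-sym x y ⟩
    d y x         ∎
    where open ≡-Reasoning

  InInterval⇒Between : ∀ {x y m} → InInterval G x y m → Between x m y
  InInterval⇒Between (_ , _ , _ , xm , my , xy , e)
    rewrite Dist⇒≡d xm | Dist⇒≡d my | Dist⇒≡d xy = e

  Between⇒InInterval : ∀ {x y m} → Between x m y → InInterval G x y m
  Between⇒InInterval {x} {y} {m} b =
    d x m , d m y , d x y , Dist-d x m , Dist-d m y , Dist-d x y , b

  step-towards : ∀ {m y} → m ≢ y → ∃ λ w → Adj G y w × (∀ {x} → Between x m y → d x w < d x y)
  step-towards {m} {y} m≢y with d y m in e
  ... | zero = contradiction (sym (d≡0⇒≡ e)) m≢y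
  ... | suc k with geodesic-step e
  ...   | w , yw , wm = w , yw , λ {x} b → begin-strict
    d x w         ≤⟨ d-triangle x m w ⟩
    d x m + d m w ≡⟨ cong (d x m +_) (trans (d-sym m w) wm) ⟩
    d x m + k     <⟨ +-monoʳ-< (d x m) (n<1+n k) ⟩
    d x m + suc k ≡⟨ cong (d x m +_) (trans (sym e) (d-sym y m)) ⟩
    d x m + d m y ≡⟨ b ⟩
    d x y         ∎
    where open ≤-Reasoning

module Median (G : Graph) (conn : Connected G) (median : IsMedian G) where
  open Distance G conn public

  med : V G → V G → V G → V G
  med x y z = proj₁ (median x y z)

  med-between₁ : ∀ x y z → Between x (med x y z) y
  med-between₁ x y z = InInterval⇒Between (proj₁ (proj₁ (proj₂ (median x y z))))

  med-between₂ : ∀ x y z → Between y (med x y z) z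
  med-between₂ x y z = InInterval⇒Between (proj₁ (proj₂ (proj₁ (proj₂ (median x y z)))))

  med-between₃ : ∀ x y z → Between z (med x y z) x
  med-between₃ x y z = InInterval⇒Between (proj₂ (proj₂ (proj₁ (proj₂ (median x y z)))))

  med-unique : ∀ {x y z m} → Between x m y → Between y m z → Between z m x → m ≡ med x y z
  med-unique {x} {y} {z} {m} b₁ b₂ b₃ =
    proj₂ (proj₂ (median x y z)) m
      (Between⇒InInterval b₁ , Between⇒InInterval b₂ , Between⇒InInterval b₃)

  between-adjacent : ∀ {x y m} → Adj G x y → Between x m y → m ≡ x ⊎ m ≡ y
  between-adjacent {x} {y} {m} a b with d x m in e
  ... | zero = inj₁ (sym (d≡0⇒≡ e))
  ... | suc k = inj₂ (d≡0⇒≡ (m+n≡0⇒n≡0 k (suc-injective (trans b (Adj⇒d≡1 a)))))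

  adjacent-distances : ∀ {x y} → Adj G x y → ∀ z → d z y ≡ suc (d z x) ⊎ d z x ≡ suc (d z y)
  adjacent-distances {x} {y} a z with between-adjacent a (med-between₂ z x y)
  ... | inj₁ m≡x = inj₁ (begin
    d z y         ≡⟨ d-sym z y ⟩
    d y z         ≡⟨ subst (λ t → Between y t z) m≡x (med-between₃ z x y) ⟨
    d y x + d x z ≡⟨ cong₂ _+_ (trans (d-sym y x) (Adj⇒d≡1 a)) (d-sym x z) ⟩
    suc (d z x)   ∎)
    where open ≡-Reasoning
  ... | inj₂ m≡y = inj₂ (begin
    d z x         ≡⟨ subst (λ t → Between z t x) m≡y (med-between₁ z x y) ⟨
    d z y + d y x ≡⟨ cong (d z y +_) (trans (d-sym y x) (Adj⇒d≡1 a)) ⟩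
    d z y + 1     ≡⟨ +-comm (d z y) 1 ⟩
    suc (d z y)   ∎)
    where open ≡-Reasoning

  equidistant⇒¬Adj : ∀ {x y z} → d z x ≡ d z y → ¬ Adj G x y
  equidistant⇒¬Adj {z = z} e a with adjacent-distances a z
  ... | inj₁ e′ = 1+n≢n (trans (sym e′) (sym e))
  ... | inj₂ e′ = 1+n≢n (trans (sym e′) e)

  quadrangle : ∀ {y₁ y₂ z} → d y₁ y₂ ≡ 2 → d z y₁ ≡ d z y₂ →
               ∃ λ m → Adj G y₁ m × Adj G y₂ m × suc (d z m) ≡ d z y₁
  quadrangle {y₁} {y₂} {z} y₁y₂ zy₁≡zy₂ =
    m , d≡1⇒Adj (trans (d-sym y₁ m) my₁≡1) , d≡1⇒Adj (trans (d-sym y₂ m) my₂≡1) ,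
    trans (+-comm 1 (d z m)) (subst (λ t → d z m + t ≡ d z y₁) my₁≡1 (med-between₃ y₁ y₂ z))
    where
      m = med y₁ y₂ z
      my₁≡my₂ : d m y₁ ≡ d m y₂
      my₁≡my₂ = +-cancelˡ-≡ (d z m) _ _
        (trans (med-between₃ y₁ y₂ z) (trans zy₁≡zy₂ (sym (Between-sym (med-between₂ y₁ y₂ z)))))
      my₂≡1 : d m y₂ ≡ 1
      my₂≡1 = n+n≡2⇒n≡1 (trans (cong (_+ d m y₂) (trans (sym my₁≡my₂) (d-sym m y₁)))
                                (trans (med-between₁ y₁ y₂ z) y₁y₂))
      my₁≡1 : d m y₁ ≡ 1
      my₁≡1 = trans my₁≡my₂ my₂≡1

  common-neighbour≡med : ∀ {y₁ y₂ z m} → Adj G y₁ m → Adj G y₂ m → d y₁ y₂ ≡ 2 →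
                         suc (d z m) ≡ d z y₁ → suc (d z m) ≡ d z y₂ → m ≡ med y₁ y₂ z
  common-neighbour≡med {y₁} {y₂} {z} {m} y₁m y₂m y₁y₂ zy₁ zy₂ = med-unique
    (trans (cong₂ _+_ (Adj⇒d≡1 y₁m) (Adj⇒d≡1 (Adj-sym y₂m))) (sym y₁y₂))
    (trans (cong₂ _+_ (Adj⇒d≡1 y₂m) (d-sym m z)) (trans zy₂ (d-sym z y₂)))
    (trans (cong (d z m +_) (Adj⇒d≡1 (Adj-sym y₁m))) (trans (+-comm (d z m) 1) zy₁))

  W : V G → V G → V G → Set
  W a b z = d z a < d z b

  W-dichotomy : ∀ {p q} → Adj G p q → ∀ z → W p q z ⊎ W q p z
  W-dichotomy pq z with adjacent-distances pq z
  ... | inj₁ e = inj₁ (≤-reflexive (sym e))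
  ... | inj₂ e = inj₂ (≤-reflexive (sym e))

  W-step : ∀ {p q z} → Adj G p q → W p q z → d z q ≡ suc (d z p)
  W-step {z = z} pq zp with adjacent-distances pq z
  ... | inj₁ e = e
  ... | inj₂ e = contradiction (≤-reflexive (sym e)) (<-asym zp)

  across-edge-levels : ∀ {p q y w} → Adj G p q → Adj G y w → W p q y → W q p w → d y p ≡ d w q
  across-edge-levels {p} {q} {y} {w} pq yw yp wq = ≤-antisym
    (≤-pred (begin
      suc (d y p) ≡⟨ W-step pq yp ⟨
      d y q       ≤⟨ d-adjˡ q yw ⟩
      suc (d w q) ∎))
    (≤-pred (begin
      suc (d w q) ≡⟨ W-step (Adj-sym pq) wq ⟨
      d w p       ≤⟨ d-adjˡ p (Adj-sym yw) ⟩
      suc (d y p) ∎))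
    where open ≤-Reasoning

  -- Two such neighbours y₁ ≠ y₂ would have a second common neighbour m
  -- closer to p; both m and w would then be the median of y₁, y₂ and q.
  neighbour-across-unique : ∀ {p q w y₁ y₂} → Adj G p q → W q p w →
    Adj G y₁ w → Adj G y₂ w → W p q y₁ → W p q y₂ → y₁ ≡ y₂
  neighbour-across-unique {p} {q} {w} {y₁} {y₂} pq wq y₁w y₂w y₁p y₂p with y₁ Fin.≟ y₂
  ... | yes y₁≡y₂ = y₁≡y₂
  ... | no y₁≢y₂ = contradiction (trans (cong suc (sym pw)) (subst (λ t → suc (d p t) ≡ β) m≡w pm))
                                 (m≢1+n+m β ∘ sym)
    where
      β = d w q
      py₁ : d p y₁ ≡ β
      py₁ = trans (d-sym p y₁) (across-edge-levels pq y₁w y₁p wq)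
      py₂ : d p y₂ ≡ β
      py₂ = trans (d-sym p y₂) (across-edge-levels pq y₂w y₂p wq)
      qy : ∀ {y} → Adj G y w → W p q y → d q y ≡ suc β
      qy yw yp = trans (d-sym q _)
        (trans (W-step pq yp) (cong suc (across-edge-levels pq yw yp wq)))
      pw : d p w ≡ suc β
      pw = trans (d-sym p w) (W-step (Adj-sym pq) wq)
      y₁y₂ : d y₁ y₂ ≡ 2
      y₁y₂ = d≡2 y₁≢y₂ y₁w y₂w (equidistant⇒¬Adj (trans py₁ (sym py₂)))
      quad = quadrangle {z = p} y₁y₂ (trans py₁ (sym py₂))
      m = proj₁ quad
      y₁m = proj₁ (proj₂ quad)
      y₂m = proj₁ (proj₂ (proj₂ quad))
      pm : suc (d p m) ≡ β
      pm = trans (proj₂ (proj₂ (proj₂ quad))) py₁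
      qm : d q m ≡ β
      qm = ≤-antisym
        (begin
          d q m       ≡⟨ d-sym q m ⟩
          d m q       ≤⟨ d-adjʳ m pq ⟩
          suc (d m p) ≡⟨ cong suc (d-sym m p) ⟩
          suc (d p m) ≡⟨ pm ⟩
          β           ∎)
        (≤-pred (begin
          suc β       ≡⟨ qy y₁w y₁p ⟨
          d q y₁      ≤⟨ d-adjʳ q (Adj-sym y₁m) ⟩
          suc (d q m) ∎))
        where open ≤-Reasoning
      median-of-y₁y₂q : ∀ {n} → Adj G y₁ n → Adj G y₂ n → d q n ≡ β → n ≡ med y₁ y₂ q
      median-of-y₁y₂q y₁n y₂n qn = common-neighbour≡med y₁n y₂n y₁y₂
        (trans (cong suc qn) (sym (qy y₁w y₁p))) (trans (cong suc qn) (sym (qy y₂w y₂p)))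
      m≡w : m ≡ w
      m≡w = trans (median-of-y₁y₂q y₁m y₂m qm) (sym (median-of-y₁y₂q y₁w y₂w (d-sym q w)))

  square-across : ∀ {p′ q′ p q r s} → Adj G p′ q′ →
    Adj G p q → Adj G q r → Adj G s p → p ≢ r → q ≢ s →
    W p′ q′ p → W q′ p′ q → W q′ p′ r × W p′ q′ s
  square-across p′q′ pq qr sp p≢r q≢s pW qW =
    [ (λ rW → contradiction (neighbour-across-unique p′q′ qW pq (Adj-sym qr) pW rW) p≢r) , id ]′
      (W-dichotomy p′q′ _) ,
    [ (λ sW → contradiction (neighbour-across-unique (Adj-sym p′q′) pW (Adj-sym pq) sp qW sW) q≢s) , id ]′
      (W-dichotomy (Adj-sym p′q′) _)

  module Cut {u v} (uv : Adj G u v) where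

    Crosses : V G × V G → Set
    Crosses (c , c′) = (W u v c × W v u c′) ⊎ (W v u c × W u v c′)

    Crosses-uv : Crosses (u , v)
    Crosses-uv = inj₁ (subst (_< d u v) (sym (d-refl u)) (≤-reflexive (sym (Adj⇒d≡1 uv))) ,
                       subst (_< d v u) (sym (d-refl v)) (≤-reflexive (sym (Adj⇒d≡1 (Adj-sym uv)))))

    Crosses-ThetaStep : ∀ {e f} → Crosses e → ThetaStep G e f → Crosses f
    Crosses-ThetaStep (inj₁ (aW , bW)) (inj₁ (ab , _ , inj₁ (bc , c′a) , _ , a≢c , _ , _ , b≢c′ , _)) =
      inj₂ (square-across uv ab bc c′a a≢c b≢c′ aW bW)
    Crosses-ThetaStep (inj₂ (aW , bW)) (inj₁ (ab , _ , inj₁ (bc , c′a) , _ , a≢c , _ , _ , b≢c′ , _)) =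
      inj₁ (square-across (Adj-sym uv) ab bc c′a a≢c b≢c′ aW bW)
    Crosses-ThetaStep (inj₁ (aW , bW)) (inj₁ (ab , _ , inj₂ (bc′ , ca) , _ , _ , a≢c′ , b≢c , _ , _)) =
      inj₁ (Prod.swap (square-across uv ab bc′ ca a≢c′ b≢c aW bW))
    Crosses-ThetaStep (inj₂ (aW , bW)) (inj₁ (ab , _ , inj₂ (bc′ , ca) , _ , _ , a≢c′ , b≢c , _ , _)) =
      inj₂ (Prod.swap (square-across (Adj-sym uv) ab bc′ ca a≢c′ b≢c aW bW))
    Crosses-ThetaStep cr (inj₂ (inj₁ (refl , refl))) = cr
    Crosses-ThetaStep (inj₁ (aW , bW)) (inj₂ (inj₂ (refl , refl))) = inj₂ (bW , aW)
    Crosses-ThetaStep (inj₂ (aW , bW)) (inj₂ (inj₂ (refl , refl))) = inj₁ (bW , aW)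

    Crosses-Θ : ∀ {e f} → Crosses e → Θ G e f → Crosses f
    Crosses-Θ cr ε = cr
    Crosses-Θ cr (s ◅ ss) = Crosses-Θ (Crosses-ThetaStep cr s) ss

module BFSOrder (G : Graph) (conn : Connected G) (v₀ : V G) (B : BFS G v₀) where
  open Distance G conn
  open BFS B

  level : V G → ℕ
  level = d v₀

  rank : V G → ℕ
  rank z = toℕ (pos z)

  level-adj : ∀ {x y} → Adj G x y → level y ≤ suc (level x)
  level-adj = d-adjʳ v₀

  0<level⇒≢v₀ : ∀ {y} → 0 < level y → y ≢ v₀
  0<level⇒≢v₀ lt refl = <-irrefl (sym (d-refl v₀)) lt

  parent-level : ∀ k → (∀ {x y} → level x ≤ k → level x < level y → rank x < rank y) →
                 ∀ {y p} → level y ≡ suc k → IsFirstNeighbour G v₀ pos p y → level p ≡ k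
  parent-level k rank-mono {y} {p} y≡1+k (py , _ , p-first)
    with geodesic-step (trans (d-sym y v₀) y≡1+k)
  ... | w , yw , wv₀ = ≤-antisym
    (≮⇒≥ λ k<p → <⇒≱ (rank-mono (≤-reflexive w≡k) (subst (_< level p) (sym w≡k) k<p))
                      (p-first w (Adj-sym yw)))
    (≤-pred (subst (_≤ suc (level p)) y≡1+k (level-adj py)))
    where
      w≡k : level w ≡ k
      w≡k = trans (d-sym v₀ w) wv₀

  -- Parents of vertices at level k+1 lie at level k, so the insertion axiom
  -- of the BFS lifts the claim from level k to level k+1.
  rank-mono-below : ∀ k {x y} → level x ≤ k → level x < level y → rank x < rank y
  rank-mono-below zero {x} {y} x≤0 x<y with d≡0⇒≡ (n≤0⇒n≡0 x≤0)
  ... | refl = ≤∧≢⇒< (root-first y)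
                 (λ e → 0<level⇒≢v₀ (subst (_< level y) (d-refl v₀) x<y) (sym (pos-inj (toℕ-injective e))))
  rank-mono-below (suc k) {x} {y} x≤1+k x<y with m≤n⇒m<n∨m≡n x≤1+k
  ... | inj₁ x<1+k = rank-mono-below k (≤-pred x<1+k) x<y
  ... | inj₂ x≡1+k =
    insertion x y p r x≢v₀ y≢v₀ p-first r-first
      (rank-mono-below k (≤-reflexive p≡k) (subst (_< level r) (sym p≡k) k<r))
    where
      x≢v₀ = 0<level⇒≢v₀ (subst (0 <_) (sym x≡1+k) z<s)
      y≢v₀ = 0<level⇒≢v₀ (≤-trans (s≤s z≤n) x<y)
      p = proj₁ (parent x x≢v₀)
      p-first = proj₂ (parent x x≢v₀)
      r = proj₁ (parent y y≢v₀)
      r-first = proj₂ (parent y y≢v₀)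
      p≡k : level p ≡ k
      p≡k = parent-level k (rank-mono-below k) x≡1+k p-first
      k<r : k < level r
      k<r = ≤-pred (≤-trans (subst (_< level y) x≡1+k x<y) (level-adj (proj₁ r-first)))

  rank-mono : ∀ {x y} → level x < level y → rank x < rank y
  rank-mono = rank-mono-below _ ≤-refl

  lo-ordered : ∀ {a b} → rank a < rank b → lo G v₀ B a b ≡ a × hi G v₀ B a b ≡ b
  lo-ordered {a} {b} a<b with rank a <ᵇ rank b | <⇒<ᵇ a<b
  ... | true | _ = refl , refl

  lo-reversed : ∀ {a b} → rank b < rank a → lo G v₀ B a b ≡ b × hi G v₀ B a b ≡ a
  lo-reversed {a} {b} b<a with rank a <ᵇ rank b in e
  ... | false = refl , refl
  ... | true = contradiction (<ᵇ⇒< (rank a) (rank b) (subst T (sym e) tt)) (<-asym b<a)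

  lo-either : ∀ a b → lo G v₀ B a b ≡ a ⊎ lo G v₀ B a b ≡ b
  lo-either a b with rank a <ᵇ rank b
  ... | true = inj₁ refl
  ... | false = inj₂ refl

  lo-sym : ∀ a b → lo G v₀ B a b ≡ lo G v₀ B b a
  lo-sym a b with <-cmp (rank a) (rank b)
  ... | tri< a<b _ _ = trans (proj₁ (lo-ordered a<b)) (sym (proj₁ (lo-reversed a<b)))
  ... | tri> _ _ b<a = trans (proj₁ (lo-reversed b<a)) (sym (proj₁ (lo-ordered b<a)))
  ... | tri≈ _ a≈b _ with pos-inj (toℕ-injective a≈b)
  ...   | refl = refl

  hi-sym : ∀ a b → hi G v₀ B a b ≡ hi G v₀ B b a
  hi-sym a b with <-cmp (rank a) (rank b)
  ... | tri< a<b _ _ = trans (proj₂ (lo-ordered a<b)) (sym (proj₂ (lo-reversed a<b)))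
  ... | tri> _ _ b<a = trans (proj₂ (lo-reversed b<a)) (sym (proj₂ (lo-ordered b<a)))
  ... | tri≈ _ a≈b _ with pos-inj (toℕ-injective a≈b)
  ...   | refl = refl

  ¬EdgeLt-same : ∀ {c c′ a b} → SameEdge G (c , c′) (a , b) → ¬ EdgeLt G v₀ B (c , c′) (a , b)
  ¬EdgeLt-same (inj₁ (refl , refl)) (inj₁ lt) = <-irrefl refl lt
  ¬EdgeLt-same (inj₁ (refl , refl)) (inj₂ (_ , lt)) = <-irrefl refl lt
  ¬EdgeLt-same {c} {c′} (inj₂ (refl , refl)) (inj₁ lt) = <-irrefl (cong rank (lo-sym c c′)) lt
  ¬EdgeLt-same {c} {c′} (inj₂ (refl , refl)) (inj₂ (_ , lt)) = <-irrefl (cong rank (hi-sym c c′)) lt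

  ¬EdgeLt-above : ∀ {a b c c′} → level a < level b → level a < level c → level a < level c′ →
                  ¬ EdgeLt G v₀ B (c , c′) (a , b)
  ¬EdgeLt-above {a} {b} {c} {c′} a<b a<c a<c′ lt with lo-ordered (rank-mono a<b)
  ... | lo≡a , _ = [ below , same ]′ lt
    where
      a<lo : level a < level (lo G v₀ B c c′)
      a<lo = [ (λ e → subst (λ t → level a < level t) (sym e) a<c) ,
               (λ e → subst (λ t → level a < level t) (sym e) a<c′) ]′ (lo-either c c′)
      below : ¬ rank (lo G v₀ B c c′) < rank (lo G v₀ B a b)
      below lt′ = <-asym (rank-mono a<lo) (subst (λ t → rank (lo G v₀ B c c′) < rank t) lo≡a lt′)
      same : ¬ (lo G v₀ B c c′ ≡ lo G v₀ B a b × rank (hi G v₀ B c c′) < rank (hi G v₀ B a b))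
      same (e , _) = <-irrefl (cong level (sym (trans e lo≡a))) a<lo

  EdgeLt-below : ∀ {a b c c′} → level c < level c′ → level c < level a → level a < level b →
                 EdgeLt G v₀ B (c′ , c) (a , b)
  EdgeLt-below c<c′ c<a a<b = inj₁ (subst₂ (λ s t → rank s < rank t)
    (sym (proj₁ (lo-reversed (rank-mono c<c′)))) (sym (proj₁ (lo-ordered (rank-mono a<b)))) (rank-mono c<a))

module FirstEdges (G : Graph) (conn : Connected G) (median : IsMedian G) (v₀ : V G) (B : BFS G v₀) where
  open Median G conn median
  open BFSOrder G conn v₀ B

  IsPred⇒level< : ∀ {w v} → IsPred G v₀ B w v → level w < level v
  IsPred⇒level< (_ , _ , _ , Dw , Dv , lt) = subst₂ _<_ (Dist⇒≡d Dw) (Dist⇒≡d Dv) lt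

  level<⇒IsPred : ∀ {w v} → Adj G w v → level w < level v → IsPred G v₀ B w v
  level<⇒IsPred {w} {v} wv lt = wv , level w , level v , Dist-d v₀ w , Dist-d v₀ v , lt

  module _ {u v} (uv : Adj G u v) (u<v : level u < level v) where
    open Cut uv

    first⇒pred-unique : FirstOfClass G v₀ B u v → ∀ w → IsPred G v₀ B w v → w ≡ u
    first⇒pred-unique first w wv with w Fin.≟ u
    ... | yes w≡u = w≡u
    ... | no w≢u = contradiction (EdgeLt-below x<w x<u u<v) (first w x wx (inj₁ square ◅ ε))
      where
        w≈u : level w ≡ level u
        w≈u = suc-injective (trans (sym (W-step (proj₁ wv) (IsPred⇒level< wv))) (W-step uv u<v))
        quad = quadrangle {z = v₀} (d≡2 (w≢u ∘ sym) uv (proj₁ wv) (equidistant⇒¬Adj (sym w≈u))) (sym w≈u)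
        x = proj₁ quad
        ux = proj₁ (proj₂ quad)
        wx = proj₁ (proj₂ (proj₂ quad))
        x<u : level x < level u
        x<u = ≤-reflexive (proj₂ (proj₂ (proj₂ quad)))
        x<w : level x < level w
        x<w = subst (level x <_) (sym w≈u) x<u
        square : Opposite G (u , v) (w , x)
        square = uv , wx , inj₁ (Adj-sym (proj₁ wv) , Adj-sym ux) ,
                 Adj-irrefl uv , w≢u ∘ sym , Adj-irrefl ux , Adj-irrefl (Adj-sym (proj₁ wv)) ,
                 (λ v≡x → <-irrefl (cong level (sym v≡x)) (<-trans x<u u<v)) , Adj-irrefl wx

    -- The median of v₀, z and v is v itself: otherwise a step from v towards
    -- it would be a predecessor of v closer to z than v is.
    W-gated : (∀ w → IsPred G v₀ B w v → w ≡ u) → ∀ {z} → W v u z → level v + d v z ≡ level z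
    W-gated pred-unique {z} zv with v Fin.≟ med v₀ z v
    ... | yes v≡m = subst (λ t → Between v₀ t z) (sym v≡m) (med-between₁ v₀ z v)
    ... | no v≢m with step-towards (v≢m ∘ sym)
    ...   | w , vw , closer =
      contradiction (subst (λ t → d z t < d z v) w≡u (closer (med-between₂ v₀ z v))) (<-asym zv)
      where
        w≡u : w ≡ u
        w≡u = pred-unique w (level<⇒IsPred (Adj-sym vw) (closer (Between-sym (med-between₃ v₀ z v))))

    crossing-edge : (∀ w → IsPred G v₀ B w v → w ≡ u) → ∀ {p q} → Adj G p q → W v u q →
                    (p ≡ u × q ≡ v) ⊎ (level u < level p × level u < level q)
    crossing-edge pred-unique {p} {q} pq qv with d v q in e
    ... | suc k = inj₂ (<-≤-trans u<v (≤-pred (<-≤-trans v<q (level-adj pq))) , <-trans u<v v<q)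
      where
        v<q : level v < level q
        v<q = subst (level v <_) (trans (cong (level v +_) (sym e)) (W-gated pred-unique qv))
                    (m<m+n (level v) z<s)
    ... | zero with d≡0⇒≡ e
    ...   | refl with level p <? level v
    ...     | yes p<v = inj₁ (pred-unique p (level<⇒IsPred pq p<v) , refl)
    ...     | no p≮v = inj₂ (<-≤-trans u<v (≮⇒≥ p≮v) , u<v)

    pred-unique⇒first : (∀ w → IsPred G v₀ B w v → w ≡ u) → FirstOfClass G v₀ B u v
    pred-unique⇒first pred-unique c c′ cc′ θ with Crosses-Θ Crosses-uv θ
    ... | inj₁ (_ , c′v) =
      [ (λ (c≡u , c′≡v) → ¬EdgeLt-same (inj₁ (c≡u , c′≡v))) ,
        (λ (u<c , u<c′) → ¬EdgeLt-above u<v u<c u<c′) ]′ (crossing-edge pred-unique cc′ c′v)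
    ... | inj₂ (cv , _) =
      [ (λ (c′≡u , c≡v) → ¬EdgeLt-same (inj₂ (c≡v , c′≡u))) ,
        (λ (u<c′ , u<c) → ¬EdgeLt-above u<v u<c u<c′) ]′ (crossing-edge pred-unique (Adj-sym cc′) cv)

lemma4p1 : (G : Graph) → Connected G → IsMedian G →
    (v₀ : V G) (B : BFS G v₀) (u v : V G) → Adj G u v →
    (a b : ℕ) → Dist G v₀ u a → Dist G v₀ v b → a < b →
    FirstOfClass G v₀ B u v ⇔ PredsSingleton G v₀ B u v
lemma4p1 G conn median v₀ B u v uv a b Du Dv a<b =
  mk⇔ (λ first → uv-pred , first⇒pred-unique uv u<v first)
      (λ (_ , pred-unique) → pred-unique⇒first uv u<v pred-unique)
  where
    open FirstEdges G conn median v₀ B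
    uv-pred : IsPred G v₀ B u v
    uv-pred = uv , a , b , Du , Dv , a<b
    u<v = IsPred⇒level< uv-pred
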